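{- For all integers $\Delta\ge 2$ and $d\ge 1$, in every graph with maximum degree at most $\Delta$, every distance-$d$ semi-ladder has order at most $\Delta^d+1$.
   Context: All graphs are finite, undirected and simple; $\mathrm{dist}$ is the shortest-path distance. For integers $d,\ell\ge 1$, $2\ell$ pairwise distinct vertices $a_1,\dots,a_\ell,b_1,\dots,b_\ell$ of a graph form a distance-$d$ semi-ladder of order $\ell$ if $\mathrm{dist}(b_i,a_j)\le d$ for all $1\le i<j\le \ell$, and $\mathrm{dist}(b_i,a_i)>d$ for every $i\in[1,\ell]$. -}

module Defs where

open import Data.Nat using (ℕ; zero; suc; _+_; _≤_)
open import Data.Bool using (Bool; true; false; if_then_else_)
open import Data.Fin using (Fin; _<_)
open import Data.List using (List; map; allFin)
open import Data.Nat.ListAction using (sum)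
open import Data.Product using (Σ; _×_; ∃-syntax)
open import Relation.Binary.PropositionalEquality using (_≡_; _≢_)
open import Relation.Nullary using (¬_)
open import Function.Definitions using (Injective)

record Graph : Set where
  field
    n     : ℕ
    adj   : Fin n → Fin n → Bool
    sym   : ∀ u v → adj u v ≡ adj v u
    irrefl : ∀ v → adj v v ≡ false

open Graph public

degree : (G : Graph) → Fin (n G) → ℕ
degree G v = sum (map (λ u → if adj G v u then 1 else 0) (allFin (n G)))

MaxDegreeAtMost : Graph → ℕ → Set
MaxDegreeAtMost G Δ = ∀ v → degree G v ≤ Δ

data Walk (G : Graph) : Fin (n G) → Fin (n G) → ℕ → Set where
  here : ∀ {u} → Walk G u u zero
  step : ∀ {u w v k} → adj G u w ≡ true → Walk G w v k → Walk G u v (suc k)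

DistLe : (G : Graph) → Fin (n G) → Fin (n G) → ℕ → Set
DistLe G u v d = ∃[ k ] (k ≤ d × Walk G u v k)

record IsSemiLadder (G : Graph) (d ℓ : ℕ) (a b : Fin ℓ → Fin (n G)) : Set where
  field
    a-inj    : Injective _≡_ _≡_ a
    b-inj    : Injective _≡_ _≡_ b
    a≢b      : ∀ i j → a i ≢ b j
    close    : ∀ i j → i < j → DistLe G (b i) (a j) d
    far      : ∀ i → ¬ DistLe G (b i) (a i) d

-- a₂, …, a_ℓ are distinct vertices other than b₁ within distance d of b₁, so it
-- suffices that at most Δ^d vertices other than x lie within distance d of x.
-- Each vertex y ≠ x there ends a non-backtracking walk from x of length at most d,
-- and listing the neighbour indices (< Δ) taken along it, padded by the index of
-- the step back, is a word of length d from which y can be read off.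

module Submission where

open import Defs hiding (sym)
open import Data.Nat using (ℕ; zero; suc; _≤_; _+_; _^_; z≤n; s≤s; z<s)
open import Data.Nat.Properties using (≤-trans; ≤-reflexive; +-comm; n≤1+n; m≤n⇒m≤1+n)
open import Data.Nat.ListAction using (sum)
open import Data.Bool using (Bool; true; false; if_then_else_; T)
open import Data.Fin using (Fin; toℕ; fromℕ<; funToFin; finToFun)
  renaming (zero to fzero; suc to fsuc)
open import Data.Fin.Properties using (_≟_; toℕ<n; toℕ-fromℕ<; suc-injective; injective⇒≤; finToFun-funToFin)
open import Data.List using (List; []; _∷_; length; map; allFin; filterᵇ)
open import Data.List.Relation.Unary.Any using (here; there; index)
open import Data.List.Membership.Propositional using (_∈_)
open import Data.List.Membership.Propositional.Properties using (∈-allFin; ∈-filter⁺)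
open import Data.Maybe using (Maybe; just; nothing)
open import Data.Maybe.Properties using (just-injective) renaming (≡-dec to ≡-decMaybe)
open import Data.Vec using (Vec; []; _∷_; replicate; lookup; tabulate)
open import Data.Vec.Properties using (tabulate∘lookup; tabulate-cong)
open import Data.Product using (Σ; _×_; _,_; proj₁; proj₂; ∃-syntax)
open import Data.Unit using (⊤; tt)
open import Data.Empty using (⊥-elim)
open import Relation.Nullary using (yes; no)
open import Relation.Nullary.Decidable using (T?)
open import Relation.Binary.PropositionalEquality
  using (_≡_; _≢_; refl; sym; trans; cong; subst; module ≡-Reasoning)
open import Function using (_∘_)
open import Function.Definitions using (Injective)

lookupMaybe : {A : Set} → List A → ℕ → Maybe A
lookupMaybe []       _       = nothing
lookupMaybe (x ∷ xs) zero    = just x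
lookupMaybe (x ∷ xs) (suc i) = lookupMaybe xs i

lookupMaybe-index : {A : Set} {x : A} {xs : List A} (x∈xs : x ∈ xs) →
                    lookupMaybe xs (toℕ (index x∈xs)) ≡ just x
lookupMaybe-index (here refl) = refl
lookupMaybe-index (there x∈xs) = lookupMaybe-index x∈xs

length-filterᵇ : {A : Set} (p : A → Bool) (xs : List A) →
                 length (filterᵇ p xs) ≡ sum (map (λ x → if p x then 1 else 0) xs)
length-filterᵇ p [] = refl
length-filterᵇ p (x ∷ xs) with p x
... | true  = cong suc (length-filterᵇ p xs)
... | false = length-filterᵇ p xs

vecToFin : ∀ {Δ m} → Vec (Fin Δ) m → Fin (Δ ^ m)
vecToFin = funToFin ∘ lookup

vecToFin-injective : ∀ {Δ m} → Injective _≡_ _≡_ (vecToFin {Δ} {m})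
vecToFin-injective {x = w} {w′} eq = begin
  w                    ≡⟨ sym (tabulate∘lookup w) ⟩
  tabulate (lookup w)  ≡⟨ tabulate-cong lookup-equal ⟩
  tabulate (lookup w′) ≡⟨ tabulate∘lookup w′ ⟩
  w′                   ∎
  where
  open ≡-Reasoning
  lookup-equal : ∀ i → lookup w i ≡ lookup w′ i
  lookup-equal i = trans (sym (finToFun-funToFin (lookup w) i))
                     (trans (cong (λ k → finToFun k i) eq) (finToFun-funToFin (lookup w′) i))

injective-into-words⇒≤ : ∀ {ℓ Δ m} (f : Fin ℓ → Vec (Fin Δ) m) → Injective _≡_ _≡_ f → ℓ ≤ Δ ^ m
injective-into-words⇒≤ f f-inj = injective⇒≤ (f-inj ∘ vecToFin-injective)

module _ (G : Graph) where

  private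
    V : Set
    V = Fin (n G)

  adj-sym : ∀ {x y} → adj G x y ≡ true → adj G y x ≡ true
  adj-sym {x} {y} e = trans (Graph.sym G y x) e

  neighbours : V → List V
  neighbours x = filterᵇ (adj G x) (allFin (n G))

  length-neighbours : ∀ x → length (neighbours x) ≡ degree G x
  length-neighbours x = length-filterᵇ (adj G x) (allFin (n G))

  ∈-neighbours : ∀ {x y} → adj G x y ≡ true → y ∈ neighbours x
  ∈-neighbours {x} {y} e = ∈-filter⁺ (T? ∘ adj G x) (∈-allFin y) (subst T (sym e) tt)

  FirstStepAvoids : ∀ {u v k} → V → Walk G u v k → Set
  FirstStepAvoids p here = ⊤
  FirstStepAvoids p (step {w = w} _ _) = w ≢ p

  NonBacktracking : ∀ {u v k} → Walk G u v k → Set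
  NonBacktracking here = ⊤
  NonBacktracking (step {u = u} _ W) = FirstStepAvoids u W × NonBacktracking W

  removeBacktracks : ∀ {u v k} → Walk G u v k →
                     Σ ℕ λ k′ → k′ ≤ k × Σ (Walk G u v k′) NonBacktracking
  removeBacktracks here = 0 , z≤n , here , tt
  removeBacktracks (step e W) with removeBacktracks W
  ... | _ , k′≤k , here , _ = 1 , s≤s z≤n , step e here , tt , tt
  removeBacktracks {u} (step e W) | suc k′ , k′≤k , step {w = x} e′ W′ , avoids , nb with u ≟ x
  ... | yes refl = k′ , m≤n⇒m≤1+n (≤-trans (n≤1+n k′) k′≤k) , W′ , nb
  ... | no u≢x   = suc (suc k′) , s≤s k′≤k , step e (step e′ W′) , (u≢x ∘ sym) , avoids , nb

  module _ {Δ : ℕ} (maxdeg : MaxDegreeAtMost G Δ) where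

    neighbour : V → Fin Δ → Maybe V
    neighbour x c = lookupMaybe (neighbours x) (toℕ c)

    neighbour-surjective : ∀ {x y} → adj G x y ≡ true → ∃[ c ] neighbour x c ≡ just y
    neighbour-surjective {x} {y} e = fromℕ< i<Δ , (begin
      lookupMaybe (neighbours x) (toℕ (fromℕ< i<Δ)) ≡⟨ cong (lookupMaybe (neighbours x)) (toℕ-fromℕ< i<Δ) ⟩
      lookupMaybe (neighbours x) (toℕ (index y∈))   ≡⟨ lookupMaybe-index y∈ ⟩
      just y                                        ∎)
      where
      open ≡-Reasoning
      y∈ = ∈-neighbours e
      i<Δ = ≤-trans (toℕ<n (index y∈)) (≤-trans (≤-reflexive (length-neighbours x)) (maxdeg x))

    -- A word is read as a walk that at each step takes the chosen neighbour;
    -- it stops for good on a missing neighbour or on a step straight back to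
    -- the previous vertex, so a short walk is padded by repeating that step.
    decode : ∀ {m} → Maybe V → V → Vec (Fin Δ) m → V
    decode p x [] = x
    decode p x (c ∷ w) with neighbour x c
    ... | nothing = x
    ... | just y with ≡-decMaybe _≟_ p (just y)
    ...   | yes _ = x
    ...   | no _  = decode (just x) y w

    decode-forward : ∀ {m p x y c} (w : Vec (Fin Δ) m) → neighbour x c ≡ just y → p ≢ just y →
                     decode p x (c ∷ w) ≡ decode (just x) y w
    decode-forward {p = p} {y = y} w e p≢y rewrite e with ≡-decMaybe _≟_ p (just y)
    ... | yes p≡y = ⊥-elim (p≢y p≡y)
    ... | no _    = refl

    decode-back : ∀ {m p x c} (w : Vec (Fin Δ) m) → neighbour x c ≡ just p →
                  decode (just p) x (c ∷ w) ≡ x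
    decode-back {p = p} w e rewrite e with ≡-decMaybe _≟_ (just p) (just p)
    ... | yes _   = refl
    ... | no p≢p = ⊥-elim (p≢p refl)

    encode-after : ∀ m {p x v k} (W : Walk G x v k) → NonBacktracking W → FirstStepAvoids p W →
                   adj G x p ≡ true → k ≤ m → ∃[ w ] decode {m} (just p) x w ≡ v
    encode-after zero here _ _ _ _ = [] , refl
    encode-after (suc m) here _ _ x~p _ with neighbour-surjective x~p
    ... | c , e = c ∷ replicate m c , decode-back _ e
    encode-after (suc m) (step {w = y} x~y W) (avoids , nb) y≢p _ (s≤s k≤m)
      with neighbour-surjective x~y | encode-after m W nb avoids (adj-sym x~y) k≤m
    ... | c , e | w , decodes = c ∷ w , trans (decode-forward w e (y≢p ∘ just-injective ∘ sym)) decodes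

    encode : ∀ m {x v k} → x ≢ v → (W : Walk G x v k) → NonBacktracking W → k ≤ m →
             ∃[ w ] decode {m} nothing x w ≡ v
    encode m x≢v here _ _ = ⊥-elim (x≢v refl)
    encode (suc m) _ (step {w = y} x~y W) (avoids , nb) (s≤s k≤m)
      with neighbour-surjective x~y | encode-after m W nb avoids (adj-sym x~y) k≤m
    ... | c , e | w , decodes = c ∷ w , trans (decode-forward w e λ ()) decodes

    code-of-near-vertex : ∀ {m x v} → x ≢ v → DistLe G x v m → ∃[ w ] decode {m} nothing x w ≡ v
    code-of-near-vertex x≢v (k , k≤m , W) with removeBacktracks W
    ... | k′ , k′≤k , W′ , nb = encode _ x≢v W′ nb (≤-trans k′≤k k≤m)

    punctured-ball-bound : ∀ {ℓ m} x (f : Fin ℓ → V) → Injective _≡_ _≡_ f →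
                           (∀ i → x ≢ f i) → (∀ i → DistLe G x (f i) m) → ℓ ≤ Δ ^ m
    punctured-ball-bound x f f-inj x∉f near = injective-into-words⇒≤ word word-inj
      where
      code : ∀ i → ∃[ w ] decode nothing x w ≡ f i
      code i = code-of-near-vertex (x∉f i) (near i)
      word = λ i → proj₁ (code i)
      word-inj : Injective _≡_ _≡_ word
      word-inj {i} {j} eq = f-inj (trans (sym (proj₂ (code i)))
                              (trans (cong (decode nothing x) eq) (proj₂ (code j))))

theorem6p1 : (Δ d : ℕ) → 2 ≤ Δ → 1 ≤ d → (G : Graph) → MaxDegreeAtMost G Δ →
    (ℓ : ℕ) → (a b : Fin ℓ → Fin (n G)) → IsSemiLadder G d ℓ a b → ℓ ≤ Δ ^ d + 1
theorem6p1 Δ d _ _ G maxdeg zero a b L = z≤n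
theorem6p1 Δ d _ _ G maxdeg (suc ℓ) a b L =
  subst (suc ℓ ≤_) (+-comm 1 (Δ ^ d))
    (s≤s (punctured-ball-bound G maxdeg (b fzero) (a ∘ fsuc) (suc-injective ∘ a-inj)
            (λ i b≡a → a≢b (fsuc i) fzero (sym b≡a))
            (λ i → close fzero (fsuc i) z<s)))
  where open IsSemiLadder L
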